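{- Let $k\ge 2$, $n\ge 2k+2$, and let $T$ be a $k$-triangulation of a convex $n$-gon with corner $r$. Define $A_i$ and $a_i$ for $1\le i\le k-1$ as in the context. Then for every $i\in\{1,\dots,k-1\}$, either the diagonal $(a_i,r+i+1)$ belongs to $T$ or $(a_i,r+i+1)$ is a trivial diagonal.
   Context: Vertices of the convex $n$-gon are labeled $1,\dots,n$ clockwise; $(a,b)$ with $a<b$ is the diagonal joining $a,b$. Diagonals cross if they intersect in their interiors; a $k$-triangulation is a maximal set of diagonals containing no $k+1$ pairwise crossing diagonals. A diagonal is trivial if its endpoints have fewer than $k$ vertices between them on one side, i.e. $(a,b)$ with $b-a\le k$ or $a+n-b\le k$; trivial diagonals lie in every $k$-triangulation, and below "$(a,b)\in T$" refers to nontrivial diagonals of $T$. The corner of $T$ is $r=\max\{a:1\le a\le n-k-1,\ (a,a+k+1)\in T\}$ (such $a$ exists). For $i=1,\dots,k-1$ let $A_i=\{a<r+i:(a,r+i)\in T\}\cup\{r+i-k\}$; let $a_1=\min A_1$ and, for $i=2,\dots,k-1$, $a_i=\min\{a\in A_i:a>a_{i-1}\}$. -}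

module Defs where

open import Data.Nat using (ℕ; suc; _+_; _∸_; _≤_; _<_)
open import Data.Integer as ℤ using (ℤ; +_)
open import Data.Bool using (Bool; true; false)
open import Data.Fin using (Fin)
open import Data.Product using (Σ; _×_; _,_)
open import Data.Sum using (_⊎_)
open import Relation.Nullary using (¬_)
open import Relation.Binary.PropositionalEquality using (_≡_; _≢_)

-- Vertices of the convex n-gon are the naturals 1..n (clockwise).
-- A set of diagonals is a Boolean predicate T on pairs (a , b), read with a < b.

Diagonal : ℕ → ℕ → ℕ → Set
Diagonal n a b = (1 ≤ a) × (a + 1 < b) × (b ≤ n) × ¬ ((a ≡ 1) × (b ≡ n))

Crosses : ℕ × ℕ → ℕ × ℕ → Set
Crosses (a , b) (c , d) = ((a < c) × (c < b) × (b < d)) ⊎ ((c < a) × (a < d) × (d < b))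

PairwiseCrossing : (m : ℕ) → (ℕ × ℕ → Set) → (Fin m → ℕ × ℕ) → Set
PairwiseCrossing m P f = (∀ i → P (f i)) × (∀ i j → i ≢ j → Crosses (f i) (f j))

InT : (ℕ → ℕ → Bool) → ℕ × ℕ → Set
InT T (a , b) = T a b ≡ true

KTriangulation : ℕ → ℕ → (ℕ → ℕ → Bool) → Set
KTriangulation n k T =
  (∀ a b → T a b ≡ true → Diagonal n a b)
  × (∀ (f : Fin (suc k) → ℕ × ℕ) → ¬ PairwiseCrossing (suc k) (InT T) f)
  × (∀ a b → Diagonal n a b → T a b ≡ false →
       Σ (Fin (suc k) → ℕ × ℕ) λ f →
         PairwiseCrossing (suc k) (λ d → InT T d ⊎ d ≡ (a , b)) f)

-- (a , b), a < b ≤ n, is trivial: fewer than k vertices strictly between a and b on one side.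
Trivial : ℕ → ℕ → ℕ → ℕ → Set
Trivial n k a b = (b ∸ a ≤ k) ⊎ (a + n ∸ b ≤ k)

InTNontriv : ℕ → ℕ → (ℕ → ℕ → Bool) → ℕ → ℕ → Set
InTNontriv n k T a b = (T a b ≡ true) × ¬ Trivial n k a b

IsCorner : ℕ → ℕ → (ℕ → ℕ → Bool) → ℕ → Set
IsCorner n k T r =
  (1 ≤ r) × (r ≤ n ∸ (k + 1)) × InTNontriv n k T r (r + k + 1)
  × (∀ a → r < a → a ≤ n ∸ (k + 1) → ¬ InTNontriv n k T a (a + k + 1))

-- Integer-valued labels (r + i - k may be ≤ 0 a priori).
-- x ∈ A_i = {a < r+i : (a, r+i) ∈ T} ∪ {r+i-k}.
InA : ℕ → ℕ → (ℕ → ℕ → Bool) → ℕ → ℕ → ℤ → Set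
InA n k T r i x =
  (Σ ℕ λ a → (x ≡ + a) × (a < r + i) × InTNontriv n k T a (r + i))
  ⊎ (x ≡ (+ (r + i)) ℤ.- (+ k))

IsASeq : ℕ → ℕ → (ℕ → ℕ → Bool) → ℕ → (ℕ → ℤ) → Set
IsASeq n k T r a =
  ∀ i → 1 ≤ i → i ≤ k ∸ 1 →
    InA n k T r i (a i)
    × (2 ≤ i → a (i ∸ 1) ℤ.< a i)
    × (∀ x → InA n k T r i x → (2 ≤ i → a (i ∸ 1) ℤ.< x) → a i ℤ.≤ x)

InTZ : ℕ → ℕ → (ℕ → ℕ → Bool) → ℤ → ℕ → Set
InTZ n k T x b = Σ ℕ λ a → (x ≡ + a) × InTNontriv n k T a b

TrivialZ : ℕ → ℕ → ℤ → ℕ → Set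
TrivialZ n k x b = ((+ b) ℤ.- x ℤ.≤ + k) ⊎ (x ℤ.+ (+ n) ℤ.- (+ b) ℤ.≤ + k)

{-# OPTIONS --safe #-}
-- Every nontrivial diagonal (c , d) of T encloses a diagonal (a , a + k + 1) of T: if (c + 1 , d) ∉ T,
-- its maximality witness either contains a shorter (c , e) or, together with (c , d), is a (k + 1)-crossing.
-- Hence c ≤ r, and a counting argument at (r + 1 , r + k + 2) gives k ≤ r.
--
-- If (a_i , r + i + 1) ∉ T, maximality gives k mutually crossing diagonals of T all crossing it.
-- Call such a family blocking at level j if every member crosses (a_j , r + j) or ends at r + j left of a_j.
-- Adding (a_j , r + j) to a blocking family with no member ending at r + j would give k + 1 mutually crossing
-- diagonals of T. A member ending at r + j lies in A_j below a_j, so by minimality j ≥ 2 and it starts at or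
-- before a_(j-1); replacing it by (a_j , r + j) gives a family blocking at level j - 1. Descending to j = 1,
-- where no member can end at r + 1, is a contradiction.
module Submission where

open import Defs
open import Data.Nat using (ℕ; zero; suc; _+_; _*_; _∸_; _≤_; _<_; z≤n; s≤s; _≤?_; _<?_; _≟_)
open import Data.Nat.Properties
open import Data.Integer as ℤ using (ℤ; +_; ∣_∣)
import Data.Integer.Properties as ℤ
open import Data.Bool using (Bool; true; false)
open import Data.Fin as Fin using (Fin; punchIn; toℕ; fromℕ<)
import Data.Fin.Properties as Fin
open import Data.Vec.Functional using (_∷_; updateAt)
open import Data.Vec.Functional.Properties using (updateAt-updates; updateAt-minimal)
open import Data.Product using (∃; _×_; _,_; proj₁; proj₂)
open import Data.Product.Properties using (≡-dec)
open import Data.Sum using (_⊎_; inj₁; inj₂)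
open import Data.Empty using (⊥; ⊥-elim)
open import Function using (const; _∘_)
open import Function.Definitions using (Injective)
open import Relation.Nullary using (¬_; Dec; yes; no; contradiction)
open import Relation.Nullary.Decidable using (_⊎-dec_)
open import Data.Nat.Tactic.RingSolver using (solve-∀)
open import Relation.Binary.PropositionalEquality

Pair : Set
Pair = ℕ × ℕ

Endpoint : ℕ → Pair → Set
Endpoint e p = e ≡ proj₁ p ⊎ e ≡ proj₂ p

Within : ℕ → Pair → Set
Within n p = 1 ≤ proj₁ p × proj₂ p ≤ n

MutuallyCrossing : ∀ {m} → (Fin m → Pair) → Set
MutuallyCrossing G = ∀ i j → i ≢ j → Crosses (G i) (G j)

Crosses-sym : ∀ {p q} → Crosses p q → Crosses q p
Crosses-sym (inj₁ h) = inj₂ h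
Crosses-sym (inj₂ h) = inj₁ h

Crosses⇒< : ∀ {a b q} → Crosses (a , b) q → a < b
Crosses⇒< (inj₁ (a<c , c<b , _)) = <-trans a<c c<b
Crosses⇒< (inj₂ (_ , a<d , d<b)) = <-trans a<d d<b

Crosses⇒disjoint : ∀ {p q e} → Crosses p q → Endpoint e p → Endpoint e q → ⊥
Crosses⇒disjoint (inj₁ chain) e∈p e∈q = alternating chain e∈p e∈q
  where
  alternating : ∀ {x y z w e} → x < y × y < z × z < w → e ≡ x ⊎ e ≡ z → e ≡ y ⊎ e ≡ w → ⊥
  alternating (x<y , _ , _) (inj₁ refl) (inj₁ refl) = <-irrefl refl x<y
  alternating (x<y , y<z , z<w) (inj₁ refl) (inj₂ refl) = <-irrefl refl (<-trans x<y (<-trans y<z z<w))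
  alternating (_ , y<z , _) (inj₂ refl) (inj₁ refl) = <-irrefl refl y<z
  alternating (_ , _ , z<w) (inj₂ refl) (inj₂ refl) = <-irrefl refl z<w
Crosses⇒disjoint (inj₂ chain) e∈p e∈q = Crosses⇒disjoint (inj₁ chain) e∈q e∈p

Crosses-irrefl : ∀ {p} → ¬ Crosses p p
Crosses-irrefl c = Crosses⇒disjoint c (inj₁ refl) (inj₁ refl)

Crosses⇒inner-endpoint : ∀ {c d q} → Crosses (c , d) q → ∃ λ e → c < e × e < d × Endpoint e q
Crosses⇒inner-endpoint (inj₁ (c<c′ , c′<d , _)) = _ , c<c′ , c′<d , inj₁ refl
Crosses⇒inner-endpoint (inj₂ (_ , c<d′ , d′<d)) = _ , c<d′ , d′<d , inj₂ refl

injective-in-range⇒≤ : ∀ {m lo hi} (g : Fin m → ℕ) → Injective _≡_ _≡_ g →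
                       (∀ i → lo ≤ g i × g i < hi) → m ≤ hi ∸ lo
injective-in-range⇒≤ {m} {lo} {hi} g g-injective range = Fin.injective⇒≤ shifted-injective
  where
  shifted : Fin m → Fin (hi ∸ lo)
  shifted i = fromℕ< (∸-monoˡ-< (proj₂ (range i)) (proj₁ (range i)))

  shifted-injective : Injective _≡_ _≡_ shifted
  shifted-injective {i} {j} eq = g-injective (∸-cancelʳ-≡ (proj₁ (range i)) (proj₁ (range j)) (begin
    g i ∸ lo             ≡⟨ Fin.toℕ-fromℕ< _ ⟨
    toℕ (shifted i)      ≡⟨ cong toℕ eq ⟩
    toℕ (shifted j)      ≡⟨ Fin.toℕ-fromℕ< _ ⟩
    g j ∸ lo             ∎))
    where open ≡-Reasoning

mutuallyCrossing-left-injective : ∀ {m} {G : Fin m → Pair} → MutuallyCrossing G →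
                                  Injective _≡_ _≡_ (proj₁ ∘ G)
mutuallyCrossing-left-injective {G = G} cross {i} {j} eq with i Fin.≟ j
... | yes i≡j = i≡j
... | no i≢j  = ⊥-elim (Crosses⇒disjoint (cross i j i≢j) (inj₁ refl) (inj₁ eq))

mutuallyCrossing⇒long : ∀ {k} → 1 ≤ k → (G : Fin (suc k) → Pair) → MutuallyCrossing G →
                        ∀ t → proj₁ (G t) + k < proj₂ (G t)
mutuallyCrossing⇒long {k} 1≤k G cross t =
  ≤-trans (+-monoʳ-≤ (suc c) inner-count) (≤-reflexive (m+[n∸m]≡n c<d))
  where
  c d : ℕ
  c = proj₁ (G t)
  d = proj₂ (G t)

  crosses : ∀ s → Crosses (G t) (G (punchIn t s))
  crosses s = cross t (punchIn t s) (Fin.punchInᵢ≢i t s ∘ sym)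

  c<d : c < d
  c<d = Crosses⇒< (crosses (fromℕ< 1≤k))

  inner : Fin k → ℕ
  inner s = proj₁ (Crosses⇒inner-endpoint (crosses s))

  inner-range : ∀ s → c < inner s × inner s < d
  inner-range s = let _ , c<e , e<d , _ = Crosses⇒inner-endpoint (crosses s) in c<e , e<d

  inner-endpoint : ∀ s → Endpoint (inner s) (G (punchIn t s))
  inner-endpoint s = let _ , _ , _ , e∈member = Crosses⇒inner-endpoint (crosses s) in e∈member

  inner-injective : Injective _≡_ _≡_ inner
  inner-injective {s} {s′} eq with s Fin.≟ s′
  ... | yes s≡s′ = s≡s′
  ... | no s≢s′  = ⊥-elim (Crosses⇒disjoint
          (cross (punchIn t s) (punchIn t s′) (s≢s′ ∘ Fin.punchIn-injective t s s′))
          (inner-endpoint s) (subst (λ e → Endpoint e _) (sym eq) (inner-endpoint s′)))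

  inner-count : k ≤ d ∸ suc c
  inner-count = injective-in-range⇒≤ inner inner-injective inner-range

rotate : ℕ → Pair → Pair
rotate n (a , b) = b , a + n

rotate-crosses : ∀ n {p q} → Within n p → Within n q → Crosses p q → Crosses (rotate n p) (rotate n q)
rotate-crosses n (1≤a , _) (_ , d≤n) (inj₁ (a<c , c<b , b<d)) =
  inj₁ (b<d , ≤-<-trans d≤n (m<n+m n 1≤a) , +-monoˡ-< n a<c)
rotate-crosses n (_ , b≤n) (1≤c , _) (inj₂ (c<a , a<d , d<b)) =
  inj₂ (d<b , ≤-<-trans b≤n (m<n+m n 1≤c) , +-monoˡ-< n c<a)

mutuallyCrossing⇒far : ∀ {n k} → 1 ≤ k → (G : Fin (suc k) → Pair) → MutuallyCrossing G →
                       (∀ t → Within n (G t)) → ∀ t → k < proj₁ (G t) + n ∸ proj₂ (G t)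
mutuallyCrossing⇒far {n} {k} 1≤k G cross within t =
  m+n≤o⇒m≤o∸n (suc k) (subst (_≤ a + n) (cong suc (+-comm b k)) long)
  where
  a b : ℕ
  a = proj₁ (G t)
  b = proj₂ (G t)
  long : b + k < a + n
  long = mutuallyCrossing⇒long 1≤k (rotate n ∘ G)
           (λ i j i≢j → rotate-crosses n (within i) (within j) (cross i j i≢j)) t

long⇒¬short : ∀ {a b k} → a + k < b → ¬ (b ∸ a ≤ k)
long⇒¬short {a} {b} {k} long short = <⇒≱ long (≤-trans (m≤n+m∸n b a) (+-monoʳ-≤ a short))

mutuallyCrossing⇒nontrivial : ∀ {n k} → 1 ≤ k → (G : Fin (suc k) → Pair) → MutuallyCrossing G →
                              (∀ t → Within n (G t)) → ∀ t → ¬ Trivial n k (proj₁ (G t)) (proj₂ (G t))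
mutuallyCrossing⇒nontrivial 1≤k G cross within t (inj₁ short) =
  long⇒¬short (mutuallyCrossing⇒long 1≤k G cross t) short
mutuallyCrossing⇒nontrivial 1≤k G cross within t (inj₂ short) =
  <⇒≱ (mutuallyCrossing⇒far 1≤k G cross within t) short

∷-mutuallyCrossing : ∀ {m} {e} {H : Fin m → Pair} → (∀ t → Crosses e (H t)) →
                     MutuallyCrossing H → MutuallyCrossing (e ∷ H)
∷-mutuallyCrossing crosses-e cross Fin.zero    Fin.zero    0≢0 = contradiction refl 0≢0
∷-mutuallyCrossing crosses-e cross Fin.zero    (Fin.suc t) _   = crosses-e t
∷-mutuallyCrossing crosses-e cross (Fin.suc t) Fin.zero    _   = Crosses-sym (crosses-e t)
∷-mutuallyCrossing crosses-e cross (Fin.suc s) (Fin.suc t) s≢t = cross s t (s≢t ∘ cong Fin.suc)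

updateAt-view : ∀ {m} {e} (H : Fin m → Pair) i t →
                (t ≡ i × updateAt H i (const e) t ≡ e) ⊎ (t ≢ i × updateAt H i (const e) t ≡ H t)
updateAt-view H i t with t Fin.≟ i
... | yes refl = inj₁ (refl , updateAt-updates i H)
... | no t≢i   = inj₂ (t≢i , updateAt-minimal t i H t≢i)

updateAt-all : ∀ {m} (P : Pair → Set) {e} (H : Fin m → Pair) i → P e → (∀ t → t ≢ i → P (H t)) →
               ∀ t → P (updateAt H i (const e) t)
updateAt-all P H i Pe P-others t with updateAt-view H i t
... | inj₁ (_ , Gt)   = subst P (sym Gt) Pe
... | inj₂ (t≢i , Gt) = subst P (sym Gt) (P-others t t≢i)

updateAt-mutuallyCrossing : ∀ {m} {e} (H : Fin m → Pair) i → MutuallyCrossing H →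
                            (∀ t → t ≢ i → Crosses e (H t)) → MutuallyCrossing (updateAt H i (const e))
updateAt-mutuallyCrossing H i cross crosses-e s t s≢t
  with updateAt-view H i s | updateAt-view H i t
... | inj₁ (refl , _)  | inj₁ (refl , _)  = contradiction refl s≢t
... | inj₁ (_ , Gs)    | inj₂ (t≢i , Gt) = subst₂ Crosses (sym Gs) (sym Gt) (crosses-e t t≢i)
... | inj₂ (s≢i , Gs) | inj₁ (_ , Gt)    = subst₂ Crosses (sym Gs) (sym Gt) (Crosses-sym (crosses-e s s≢i))
... | inj₂ (_ , Gs)    | inj₂ (_ , Gt)    = subst₂ Crosses (sym Gs) (sym Gt) (cross s t s≢t)

CrossesOrAbuts : Pair → Pair → Set
CrossesOrAbuts p (x , w) = Crosses p (x , w) ⊎ (proj₂ p ≡ w × proj₁ p < x)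

Crosses-shrink : ∀ {p x w} → Crosses p (x , suc w) → proj₁ p ≢ w → CrossesOrAbuts p (x , w)
Crosses-shrink {p} {w = w} (inj₁ (c<x , x<d , d<1+w)) _ with proj₂ p ≟ w
... | yes d≡w = inj₂ (d≡w , c<x)
... | no d≢w  = inj₁ (inj₁ (c<x , x<d , ≤∧≢⇒< (≤-pred d<1+w) d≢w))
Crosses-shrink {w = w} (inj₂ (x<c , c<1+w , 1+w<d)) c≢w =
  inj₁ (inj₂ (x<c , ≤∧≢⇒< (≤-pred c<1+w) c≢w , <-trans (n<1+n w) 1+w<d))

CrossesOrAbuts-lower : ∀ {p x y w} → y < x → (proj₁ p < x → proj₁ p < y) →
                       CrossesOrAbuts p (x , w) → CrossesOrAbuts p (y , w)
CrossesOrAbuts-lower y<x lower (inj₁ (inj₁ (c<x , x<d , d<w))) = inj₁ (inj₁ (lower c<x , <-trans y<x x<d , d<w))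
CrossesOrAbuts-lower y<x lower (inj₁ (inj₂ (x<c , c<w , w<d))) = inj₁ (inj₂ (<-trans y<x x<c , c<w , w<d))
CrossesOrAbuts-lower y<x lower (inj₂ (d≡w , c<x))             = inj₂ (d≡w , lower c<x)

Crosses-same-right : ∀ {p c₀ x w} → Crosses p (c₀ , w) → Crosses p (x , w) →
                     proj₁ p < x → proj₁ p < c₀
Crosses-same-right (inj₁ (c<c₀ , _ , _)) _                   _   = c<c₀
Crosses-same-right (inj₂ (_ , _ , w<d))  (inj₁ (_ , _ , d<w)) _   = contradiction w<d (<-asym d<w)
Crosses-same-right (inj₂ _)              (inj₂ (x<c , _ , _)) c<x = contradiction x<c (<-asym c<x)

Crosses-extend-left : ∀ {p c d} → Crosses p (suc c , d) → proj₁ p ≢ c → Crosses p (c , d)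
Crosses-extend-left {c = c} (inj₁ (a<1+c , 1+c<b , b<d)) a≢c =
  inj₁ (≤∧≢⇒< (≤-pred a<1+c) a≢c , <-trans (n<1+n c) 1+c<b , b<d)
Crosses-extend-left {c = c} (inj₂ (1+c<a , a<d , d<b)) _ = inj₂ (<-trans (n<1+n c) 1+c<a , a<d , d<b)

Crosses-right-neighbour : ∀ {p c d} → Crosses p (suc c , d) → proj₁ p ≡ c → proj₂ p < d
Crosses-right-neighbour (inj₁ (_ , _ , b<d)) _ = b<d
Crosses-right-neighbour {c = c} (inj₂ (1+c<a , _ , _)) refl = contradiction 1+c<a (<-asym (n<1+n c))

nontrivial⇒long : ∀ {n k c d} → ¬ Trivial n k c d → c + k < d
nontrivial⇒long {k = k} {c} {d} nt with c + k <? d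
... | yes long = long
... | no ¬long =
  contradiction (inj₁ (≤-trans (∸-monoˡ-≤ c (≮⇒≥ ¬long)) (≤-reflexive (m+n∸m≡n c k)))) nt

nontrivial-inner : ∀ {n k c d c′ d′} → c ≤ c′ → d′ ≤ d → c′ + k < d′ →
                   ¬ Trivial n k c d → ¬ Trivial n k c′ d′
nontrivial-inner _ _ long _ (inj₁ short) = long⇒¬short long short
nontrivial-inner {n} c≤c′ d′≤d _ nt (inj₂ short) =
  nt (inj₂ (≤-trans (∸-mono (+-monoˡ-≤ n c≤c′) d′≤d) short))

2*k+2≡[1+k]+[1+k] : ∀ k → 2 * k + 2 ≡ suc k + suc k
2*k+2≡[1+k]+[1+k] = solve-∀

≤∸1⇒< : ∀ {j k} → 1 ≤ k → j ≤ k ∸ 1 → j < k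
≤∸1⇒< {k = suc k} _ j≤k = s≤s j≤k

+m-+n≡+[m∸n] : ∀ {m n} → n ≤ m → + m ℤ.- + n ≡ + (m ∸ n)
+m-+n≡+[m∸n] {m} {n} n≤m = trans (ℤ.m-n≡m⊖n m n) (ℤ.⊖-≥ n≤m)

Trivial⇒TrivialZ : ∀ {n k x b} → x ≤ b → b ≤ x + n → Trivial n k x b → TrivialZ n k (+ x) b
Trivial⇒TrivialZ {k = k} x≤b _ (inj₁ short) =
  inj₁ (subst (ℤ._≤ + k) (sym (+m-+n≡+[m∸n] x≤b)) (ℤ.+≤+ short))
Trivial⇒TrivialZ {k = k} _ b≤x+n (inj₂ short) =
  inj₂ (subst (ℤ._≤ + k) (sym (+m-+n≡+[m∸n] b≤x+n)) (ℤ.+≤+ short))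

module Triangulation {n k : ℕ} (1≤k : 1 ≤ k) (T : ℕ → ℕ → Bool) (tri : KTriangulation n k T) where

  NontrivialIn : Pair → Set
  NontrivialIn p = InTNontriv n k T (proj₁ p) (proj₂ p)

  InTOrShort : Pair → Set
  InTOrShort p = InT T p ⊎ proj₂ p ≤ proj₁ p + k

  EnclosesMinimal : ℕ → ℕ → Set
  EnclosesMinimal c d = ∃ λ a → c ≤ a × a + k + 1 ≤ d × InTNontriv n k T a (a + k + 1)

  inT⇒within : ∀ {a b} → T a b ≡ true → Within n (a , b)
  inT⇒within {a} {b} inT with proj₁ tri a b inT
  ... | 1≤a , _ , b≤n , _ = 1≤a , b≤n

  no-k+1-crossing : (G : Fin (suc k) → Pair) → MutuallyCrossing G → (∀ t → InT T (G t)) → ⊥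
  no-k+1-crossing G cross inT = proj₁ (proj₂ tri) G (inT , cross)

  no-k+1-crossing-of-short : (G : Fin (suc k) → Pair) → MutuallyCrossing G → (∀ t → InTOrShort (G t)) → ⊥
  no-k+1-crossing-of-short G cross inT-or-short = no-k+1-crossing G cross inT
    where
    inT : ∀ t → InT T (G t)
    inT t with inT-or-short t
    ... | inj₁ inT-t = inT-t
    ... | inj₂ short = contradiction short (<⇒≱ (mutuallyCrossing⇒long 1≤k G cross t))

  record CrossingWitness (x y : ℕ) : Set where
    constructor witness
    field
      members    : Fin k → Pair
      crossing   : MutuallyCrossing members
      nontrivial : ∀ s → NontrivialIn (members s)
      crosses-xy : ∀ s → Crosses (members s) (x , y)

  crossingWitness : ∀ {x y} → Diagonal n x y → T x y ≡ false → CrossingWitness x y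
  crossingWitness {x} {y} diagonal@(1≤x , _ , y≤n , _) notInT = record
    { members    = G ∘ punchIn i₀
    ; crossing   = λ s t s≢t → cross (punchIn i₀ s) (punchIn i₀ t) (s≢t ∘ Fin.punchIn-injective i₀ s t)
    ; nontrivial = λ s → inT (punchIn i₀ s) (Fin.punchInᵢ≢i i₀ s)
                       , mutuallyCrossing⇒nontrivial 1≤k G cross within (punchIn i₀ s)
    ; crosses-xy = λ s → crosses-new (punchIn i₀ s) (Fin.punchInᵢ≢i i₀ s)
    }
    where
    certificate : ∃ (PairwiseCrossing (suc k) (λ p → InT T p ⊎ p ≡ (x , y)))
    certificate = proj₂ (proj₂ tri) x y diagonal notInT

    G : Fin (suc k) → Pair
    G = proj₁ certificate

    inT-or-new : ∀ t → InT T (G t) ⊎ G t ≡ (x , y)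
    inT-or-new = proj₁ (proj₂ certificate)

    cross : MutuallyCrossing G
    cross = proj₂ (proj₂ certificate)

    within : ∀ t → Within n (G t)
    within t with inT-or-new t
    ... | inj₁ inT     = inT⇒within inT
    ... | inj₂ G-t≡xy = subst (Within n) (sym G-t≡xy) (1≤x , y≤n)

    new-member : ∃ λ i₀ → G i₀ ≡ (x , y)
    new-member with Fin.any? (λ t → ≡-dec _≟_ _≟_ (G t) (x , y))
    ... | yes found = found
    ... | no none   = ⊥-elim (no-k+1-crossing G cross inT)
      where
      inT : ∀ t → InT T (G t)
      inT t with inT-or-new t
      ... | inj₁ inT-t = inT-t
      ... | inj₂ G-t≡xy = contradiction (t , G-t≡xy) none

    i₀ : Fin (suc k)
    i₀ = proj₁ new-member

    crosses-new : ∀ t → t ≢ i₀ → Crosses (G t) (x , y)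
    crosses-new t t≢i₀ = subst (Crosses (G t)) (proj₂ new-member) (cross t i₀ t≢i₀)

    inT : ∀ t → t ≢ i₀ → InT T (G t)
    inT t t≢i₀ with inT-or-new t
    ... | inj₁ inT-t   = inT-t
    ... | inj₂ G-t≡xy =
      contradiction (subst (λ p → Crosses p (x , y)) G-t≡xy (crosses-new t t≢i₀)) Crosses-irrefl

  nontrivial⇒encloses-minimal : ∀ {c d} → InTNontriv n k T c d → EnclosesMinimal c d
  nontrivial⇒encloses-minimal {c} {d} = go (d ∸ c) (m≤n+m∸n d c)
    where
    go : ∀ m {c d} → d ≤ c + m → InTNontriv n k T c d → EnclosesMinimal c d
    shorten : ∀ m {c d} → d ≤ suc c + m → T c d ≡ true → ¬ Trivial n k c d → suc c + k < d →
              EnclosesMinimal c d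
    from-witness : ∀ m {c d} → d ≤ suc c + m → T c d ≡ true → CrossingWitness (suc c) d →
                   EnclosesMinimal c d

    go m {c} {d} d≤c+m cd@(inT , nt) with d ≟ suc (c + k)
    ... | yes refl = c , ≤-refl , ≤-reflexive (+-comm (c + k) 1)
                   , subst (InTNontriv n k T c) (sym (+-comm (c + k) 1)) cd
    go zero {c} d≤c+m (_ , nt) | no _ =
      contradiction (≤-trans d≤c+m (≤-trans (≤-reflexive (+-identityʳ c)) (m≤m+n c k)))
                    (<⇒≱ (nontrivial⇒long nt))
    go (suc m) {c} {d} d≤c+m (inT , nt) | no d≢ =
      shorten m (subst (d ≤_) (+-suc c m) d≤c+m) inT nt (≤∧≢⇒< (nontrivial⇒long nt) (d≢ ∘ sym))

    shorten m {c} {d} d≤1+c+m inT nt 1+c+k<d with T (suc c) d in T-1+c-d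
    ... | true  = let a , 1+c≤a , rest = go m d≤1+c+m (T-1+c-d , nontrivial-inner (n≤1+n c) ≤-refl 1+c+k<d nt)
                  in a , ≤-trans (n≤1+n c) 1+c≤a , rest
    ... | false = from-witness m d≤1+c+m inT (crossingWitness diagonal T-1+c-d)
      where
      1≤c : 1 ≤ c
      1≤c = proj₁ (inT⇒within inT)
      diagonal : Diagonal n (suc c) d
      diagonal = s≤s z≤n , ≤-<-trans (+-monoʳ-≤ (suc c) 1≤k) 1+c+k<d , proj₂ (inT⇒within inT)
               , λ (1+c≡1 , _) → <⇒≢ 1≤c (sym (suc-injective 1+c≡1))

    -- a member starting at c is a shorter diagonal to recurse on; otherwise (c , d) crosses all members
    from-witness m {c} {d} d≤1+c+m inT (witness members crossing nontrivial crosses-xy)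
      with Fin.any? (λ s → proj₁ (members s) ≟ c)
    ... | yes (s , starts) =
      let e<d = Crosses-right-neighbour (crosses-xy s) starts
          a , c≤a , a+k+1≤e , minimal = go m (≤-pred (≤-trans e<d d≤1+c+m))
                                          (subst (λ a → InTNontriv n k T a _) starts (nontrivial s))
      in a , c≤a , ≤-trans a+k+1≤e (<⇒≤ e<d) , minimal
    ... | no none = ⊥-elim (no-k+1-crossing ((c , d) ∷ members)
                     (∷-mutuallyCrossing (λ s → Crosses-sym (Crosses-extend-left (crosses-xy s) (none ∘ (s ,_))))
                                          crossing)
                     inT-all)
      where
      inT-all : ∀ t → InT T (((c , d) ∷ members) t)
      inT-all Fin.zero    = inT
      inT-all (Fin.suc s) = proj₁ (nontrivial s)

  module Corner {r : ℕ} (corner : IsCorner n k T r) where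

    corner-maximal : ∀ a → r < a → a ≤ n ∸ (k + 1) → ¬ InTNontriv n k T a (a + k + 1)
    corner-maximal = proj₂ (proj₂ (proj₂ corner))

    nontrivial⇒left≤corner : ∀ {c d} → InTNontriv n k T c d → c ≤ r
    nontrivial⇒left≤corner {c} {d} cd with c ≤? r | nontrivial⇒encloses-minimal cd
    ... | yes c≤r | _ = c≤r
    ... | no c≰r  | a , c≤a , a+k+1≤d , minimal =
      ⊥-elim (corner-maximal a (<-≤-trans (≰⇒> c≰r) c≤a) (m+n≤o⇒m≤o∸n a a+[k+1]≤n) minimal)
      where
      a+[k+1]≤n : a + (k + 1) ≤ n
      a+[k+1]≤n = subst (_≤ n) (+-assoc a k 1) (≤-trans a+k+1≤d (proj₂ (inT⇒within (proj₁ cd))))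

    -- the probe (r + 1 , r + k + 2) is not in T, and the left endpoints of its crossing witness
    -- are distinct and lie in [1 , r + 1]
    ¬corner<k : suc k + suc k ≤ n → ¬ r < k
    ¬corner<k n-large r<k with T (suc r) (suc r + suc k) in T-probe
    ... | true  = contradiction (nontrivial⇒left≤corner (T-probe , probe-nontrivial)) (1+n≰n {r})
      where
      probe-nontrivial : ¬ Trivial n k (suc r) (suc r + suc k)
      probe-nontrivial (inj₁ short) = long⇒¬short (+-monoʳ-< (suc r) (n<1+n k)) short
      probe-nontrivial (inj₂ short) =
        <⇒≱ (m+n≤o⇒m≤o∸n (suc k) n-large) (subst (_≤ k) ([m+n]∸[m+o]≡n∸o (suc r) n (suc k)) short)
    ... | false =
      <⇒≱ r<k (≤-pred (injective-in-range⇒≤ (proj₁ ∘ G) (mutuallyCrossing-left-injective cross) range))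
      where
      probe≤n : suc r + suc k ≤ n
      probe≤n = ≤-trans (+-monoˡ-≤ (suc k) (≤-trans r<k (n≤1+n k))) n-large
      diagonal : Diagonal n (suc r) (suc r + suc k)
      diagonal = s≤s z≤n , +-monoʳ-< (suc r) (s≤s 1≤k) , probe≤n
               , λ (1+r≡1 , _) → <⇒≢ (proj₁ corner) (sym (suc-injective 1+r≡1))
      open CrossingWitness (crossingWitness diagonal T-probe)
      G : Fin (suc k) → Pair
      G = (suc r , suc r + suc k) ∷ members
      cross : MutuallyCrossing G
      cross = ∷-mutuallyCrossing (Crosses-sym ∘ crosses-xy) crossing
      range : ∀ t → 1 ≤ proj₁ (G t) × proj₁ (G t) < suc (suc r)
      range Fin.zero    = s≤s z≤n , ≤-refl
      range (Fin.suc s) = proj₁ (inT⇒within (proj₁ (nontrivial s)))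
                        , s≤s (m≤n⇒m≤1+n (nontrivial⇒left≤corner (nontrivial s)))

    k≤corner : suc k + suc k ≤ n → k ≤ r
    k≤corner n-large = ≮⇒≥ (¬corner<k n-large)

    corner+k<n : k + 1 ≤ n → r + k < n
    corner+k<n k+1≤n = begin-strict
      r + k                  <⟨ +-monoʳ-< r (n<1+n k) ⟩
      r + suc k              ≡⟨ cong (λ m → r + m) (+-comm 1 k) ⟩
      r + (k + 1)            ≤⟨ +-monoˡ-≤ (k + 1) (proj₁ (proj₂ corner)) ⟩
      n ∸ (k + 1) + (k + 1)  ≡⟨ m∸n+n≡m k+1≤n ⟩
      n                      ∎
      where open ≤-Reasoning

    record Admissible (p : Pair) : Set where
      field
        inT-or-short : InTOrShort p
        far          : ¬ (proj₁ p + n ∸ proj₂ p ≤ k)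
        left≤corner  : proj₁ p ≤ r

    nontrivial⇒admissible : ∀ {p} → NontrivialIn p → Admissible p
    nontrivial⇒admissible p∈T = record
      { inT-or-short = inj₁ (proj₁ p∈T)
      ; far          = proj₂ p∈T ∘ inj₂
      ; left≤corner  = nontrivial⇒left≤corner p∈T
      }

    module Sequence (2≤k : 2 ≤ k) (n-large : suc k + suc k ≤ n) {a : ℕ → ℤ} (aseq : IsASeq n k T r a) where

      -- A_j inside ℕ: its element r + j - k is natural since k ≤ r
      InAℕ : ℕ → ℕ → Set
      InAℕ j c = (c < r + j × InTNontriv n k T c (r + j)) ⊎ c + k ≡ r + j

      k≤r+j : ∀ j → k ≤ r + j
      k≤r+j j = ≤-trans (k≤corner n-large) (m≤m+n r j)

      InA⇒InAℕ : ∀ {j x} → InA n k T r j x → x ≡ + ∣ x ∣ × InAℕ j ∣ x ∣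
      InA⇒InAℕ (inj₁ (c , refl , c<r+j , c∈T)) = refl , inj₁ (c<r+j , c∈T)
      InA⇒InAℕ {j} (inj₂ refl) rewrite ℤ.m-n≡m⊖n (r + j) k | ℤ.⊖-≥ (k≤r+j j) =
        refl , inj₂ (m∸n+n≡m (k≤r+j j))

      InAℕ⇒+k≤ : ∀ {j c} → InAℕ j c → c + k ≤ r + j
      InAℕ⇒+k≤ (inj₁ (_ , _ , nt)) = <⇒≤ (nontrivial⇒long nt)
      InAℕ⇒+k≤ (inj₂ c+k≡r+j)     = ≤-reflexive c+k≡r+j

      InAℕ⇒positive : ∀ {j c} → 1 ≤ j → InAℕ j c → 1 ≤ c
      InAℕ⇒positive _ (inj₁ (_ , inT , _)) = proj₁ (inT⇒within inT)
      InAℕ⇒positive {j} {c} 1≤j (inj₂ c+k≡r+j) = ≤-trans 1≤j (+-cancelʳ-≤ k j c j+k≤c+k)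
        where
        j+k≤c+k : j + k ≤ c + k
        j+k≤c+k = begin
          j + k  ≡⟨ +-comm j k ⟩
          k + j  ≤⟨ +-monoˡ-≤ j (k≤corner n-large) ⟩
          r + j  ≡⟨ c+k≡r+j ⟨
          c + k  ∎
          where open ≤-Reasoning

      InAℕ⇒admissible : ∀ {j c} → j < k → InAℕ j c → Admissible (c , r + j)
      InAℕ⇒admissible _ (inj₁ (_ , c∈T)) = nontrivial⇒admissible c∈T
      InAℕ⇒admissible {j} {c} j<k (inj₂ c+k≡r+j) = record
        { inT-or-short = inj₂ (≤-reflexive (sym c+k≡r+j))
        ; far          = λ short → <⇒≱ k<n∸k (subst (_≤ k) far-side short)
        ; left≤corner  = <⇒≤ (+-cancelʳ-< k c r (begin-strict
            c + k  ≡⟨ c+k≡r+j ⟩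
            r + j  <⟨ +-monoʳ-< r j<k ⟩
            r + k  ∎))
        }
        where
        open ≤-Reasoning
        far-side : c + n ∸ (r + j) ≡ n ∸ k
        far-side = trans (cong (c + n ∸_) (sym c+k≡r+j)) ([m+n]∸[m+o]≡n∸o c n k)
        k<n∸k : k < n ∸ k
        k<n∸k = m+n≤o⇒m≤o∸n (suc k) (≤-trans (+-monoʳ-≤ (suc k) (n≤1+n k)) n-large)

      α : ℕ → ℕ
      α j = ∣ a j ∣

      module _ {j : ℕ} (1≤j : 1 ≤ j) (j≤ : j ≤ k ∸ 1) where

        a≡+α : a j ≡ + α j
        a≡+α = proj₁ (InA⇒InAℕ (proj₁ (aseq j 1≤j j≤)))

        α∈A : InAℕ j (α j)
        α∈A = proj₂ (InA⇒InAℕ (proj₁ (aseq j 1≤j j≤)))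

        α+k≤r+j : α j + k ≤ r + j
        α+k≤r+j = InAℕ⇒+k≤ α∈A

        α<r+j : α j < r + j
        α<r+j = <-≤-trans (m<m+n (α j) 1≤k) α+k≤r+j

        α-admissible : Admissible (α j , r + j)
        α-admissible = InAℕ⇒admissible (≤∸1⇒< 1≤k j≤) α∈A

      α-least : ∀ {j c} → 1 ≤ j → (j≤ : j ≤ k ∸ 1) → c < r + j → InTNontriv n k T c (r + j) →
                (2 ≤ j → a (j ∸ 1) ℤ.< + c) → α j ≤ c
      α-least {j} {c} 1≤j j≤ c<r+j c∈T above = ℤ.drop‿+≤+ (subst (ℤ._≤ + c) (a≡+α 1≤j j≤)
        (proj₂ (proj₂ (aseq j 1≤j j≤)) (+ c) (inj₁ (c , refl , c<r+j , c∈T)) above))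

      α-increasing : ∀ {j} → 1 ≤ j → suc j ≤ k ∸ 1 → α j < α (suc j)
      α-increasing {j} 1≤j 1+j≤ =
        ℤ.drop‿+<+ (subst₂ ℤ._<_ (a≡+α 1≤j (≤-trans (n≤1+n j) 1+j≤)) (a≡+α (s≤s z≤n) 1+j≤)
        (proj₁ (proj₂ (aseq (suc j) (s≤s z≤n) 1+j≤)) (s≤s 1≤j)))

      α-suc<r+j : ∀ {j} → suc j ≤ k ∸ 1 → α (suc j) < r + j
      α-suc<r+j {j} 1+j≤ = ≤-pred (begin
        suc (suc (α (suc j)))  ≡⟨ +-comm 2 (α (suc j)) ⟩
        α (suc j) + 2          ≤⟨ +-monoʳ-≤ (α (suc j)) 2≤k ⟩
        α (suc j) + k          ≤⟨ α+k≤r+j (s≤s z≤n) 1+j≤ ⟩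
        r + suc j              ≡⟨ +-suc r j ⟩
        suc (r + j)            ∎)
        where open ≤-Reasoning

      record Blocking (j : ℕ) (H : Fin k → Pair) : Set where
        field
          crossing   : MutuallyCrossing H
          admissible : ∀ t → Admissible (H t)
          near       : ∀ t → CrossesOrAbuts (H t) (α j , r + j)

      witness⇒blocking : ∀ {i} → 1 ≤ i → (W : CrossingWitness (α i) (suc (r + i))) →
                         Blocking i (CrossingWitness.members W)
      witness⇒blocking {i} 1≤i (witness members crossing nontrivial crosses-xy) = record
        { crossing   = crossing
        ; admissible = nontrivial⇒admissible ∘ nontrivial
        ; near       = λ s → Crosses-shrink (crosses-xy s)
                               (<⇒≢ (≤-<-trans (nontrivial⇒left≤corner (nontrivial s)) (m<m+n r 1≤i)))
        }

      blocking-unextendable : ∀ {j H} → 1 ≤ j → j ≤ k ∸ 1 → Blocking j H →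
                              (∀ t → proj₂ (H t) ≢ r + j) → ⊥
      blocking-unextendable {j} {H} 1≤j j≤ blocking ends-elsewhere =
        no-k+1-crossing-of-short ((α j , r + j) ∷ H)
          (∷-mutuallyCrossing (Crosses-sym ∘ crosses) crossing) inT-or-short′
        where
        open Blocking blocking
        crosses : ∀ t → Crosses (H t) (α j , r + j)
        crosses t with near t
        ... | inj₁ crosses-t  = crosses-t
        ... | inj₂ (ends , _) = contradiction ends (ends-elsewhere t)
        inT-or-short′ : ∀ t → InTOrShort (((α j , r + j) ∷ H) t)
        inT-or-short′ Fin.zero    = Admissible.inT-or-short (α-admissible 1≤j j≤)
        inT-or-short′ (Fin.suc t) = Admissible.inT-or-short (admissible t)

      ending-member∈A : ∀ {j H t} → 1 ≤ j → j ≤ k ∸ 1 → Blocking j H → proj₂ (H t) ≡ r + j →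
                        proj₁ (H t) < α j × proj₁ (H t) < r + j × InTNontriv n k T (proj₁ (H t)) (r + j)
      ending-member∈A {j} {H} {t} 1≤j j≤ blocking ends = c<α , ≤-<-trans (m≤m+n c k) long , inT , nontrivial
        where
        open Blocking blocking
        open Admissible (admissible t)
        c : ℕ
        c = proj₁ (H t)
        c<α : c < α j
        c<α with near t
        ... | inj₁ crosses     = ⊥-elim (Crosses⇒disjoint crosses (inj₂ (sym ends)) (inj₂ refl))
        ... | inj₂ (_ , c<α′) = c<α′
        long : c + k < r + j
        long = <-≤-trans (+-monoˡ-< k c<α) (α+k≤r+j 1≤j j≤)
        inT : T c (r + j) ≡ true
        inT with inT-or-short
        ... | inj₁ inT′  = subst (λ d → T c d ≡ true) ends inT′
        ... | inj₂ short = contradiction (subst (_≤ c + k) ends short) (<⇒≱ long)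
        nontrivial : ¬ Trivial n k c (r + j)
        nontrivial (inj₁ short) = long⇒¬short long short
        nontrivial (inj₂ short) = far (subst (λ d → c + n ∸ d ≤ k) (sym ends) short)

      ending-member≤previous-α : ∀ {j H t} → 1 ≤ j → j ≤ k ∸ 1 → Blocking j H → proj₂ (H t) ≡ r + j →
                                 ∃ λ i → j ≡ suc i × 1 ≤ i × proj₁ (H t) ≤ α i
      ending-member≤previous-α {suc zero} 1≤j j≤ blocking ends =
        let c<α , c<r+j , c∈T = ending-member∈A 1≤j j≤ blocking ends
        in ⊥-elim (<⇒≱ c<α (α-least 1≤j j≤ c<r+j c∈T λ { (s≤s ()) }))
      ending-member≤previous-α {suc (suc i)} {H} {t} 1≤j j≤ blocking ends
        with ending-member∈A 1≤j j≤ blocking ends | α (suc i) <? proj₁ (H t)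
      ... | c<α , c<r+j , c∈T | yes above =
        ⊥-elim (<⇒≱ c<α (α-least 1≤j j≤ c<r+j c∈T λ _ →
          subst (ℤ._< + proj₁ (H t)) (sym (a≡+α (s≤s z≤n) (≤-trans (n≤1+n _) j≤))) (ℤ.+<+ above)))
      ... | _ | no ¬above = suc i , refl , s≤s z≤n , ≮⇒≥ ¬above

      blocking-descend : ∀ {j H t₁} → 1 ≤ j → suc j ≤ k ∸ 1 → Blocking (suc j) H →
                         proj₂ (H t₁) ≡ r + suc j → proj₁ (H t₁) ≤ α j →
                         Blocking j (updateAt H t₁ (const (α (suc j) , r + suc j)))
      blocking-descend {j} {H} {t₁} 1≤j 1+j≤ blocking ends c₁≤α = record
        { crossing   = updateAt-mutuallyCrossing H t₁ crossing (λ t → Crosses-sym ∘ crosses-old t)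
        ; admissible = updateAt-all Admissible H t₁ (α-admissible (s≤s z≤n) 1+j≤) (λ t _ → admissible t)
        ; near       = updateAt-all (λ p → CrossesOrAbuts p (α j , r + j)) H t₁ (inj₁ new-crosses) old-near
        }
        where
        open Blocking blocking
        crosses-t₁ : ∀ t → t ≢ t₁ → Crosses (H t) (proj₁ (H t₁) , r + suc j)
        crosses-t₁ t t≢t₁ = subst (λ d → Crosses (H t) (proj₁ (H t₁) , d)) ends (crossing t t₁ t≢t₁)

        crosses-old : ∀ t → t ≢ t₁ → Crosses (H t) (α (suc j) , r + suc j)
        crosses-old t t≢t₁ with near t
        ... | inj₁ crosses     = crosses
        ... | inj₂ (ends′ , _) =
          ⊥-elim (Crosses⇒disjoint (crosses-t₁ t t≢t₁) (inj₂ (sym ends′)) (inj₂ refl))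

        new-crosses : Crosses (α (suc j) , r + suc j) (α j , r + j)
        new-crosses = inj₂ (α-increasing 1≤j 1+j≤ , α-suc<r+j 1+j≤ , +-monoʳ-< r (n<1+n j))

        old-near : ∀ t → t ≢ t₁ → CrossesOrAbuts (H t) (α j , r + j)
        old-near t t≢t₁ =
          CrossesOrAbuts-lower (α-increasing 1≤j 1+j≤)
            (λ c<α → <-≤-trans (Crosses-same-right (crosses-t₁ t t≢t₁) (crosses-old t t≢t₁) c<α) c₁≤α)
            (Crosses-shrink (subst (λ d → Crosses (H t) (α (suc j) , d)) (+-suc r j) (crosses-old t t≢t₁))
              (<⇒≢ (≤-<-trans (Admissible.left≤corner (admissible t)) (m<m+n r 1≤j))))

      blocking-impossible : ∀ j → 1 ≤ j → j ≤ k ∸ 1 → (H : Fin k → Pair) → Blocking j H → ⊥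
      blocking-impossible j 1≤j j≤ H blocking with Fin.any? (λ t → proj₂ (H t) ≟ r + j)
      ... | no none = blocking-unextendable 1≤j j≤ blocking (λ t ends → none (t , ends))
      ... | yes (t₁ , ends) with ending-member≤previous-α 1≤j j≤ blocking ends
      ...   | i , refl , 1≤i , c₁≤α =
        blocking-impossible i 1≤i (≤-trans (n≤1+n i) j≤) _ (blocking-descend 1≤i j≤ blocking ends c₁≤α)

      r+i+1<n : ∀ {i} → i ≤ k ∸ 1 → r + i + 1 < n
      r+i+1<n {i} i≤ = begin-strict
        r + i + 1    ≡⟨ +-comm (r + i) 1 ⟩
        suc (r + i)  ≤⟨ +-monoʳ-< r (≤∸1⇒< 1≤k i≤) ⟩
        r + k        <⟨ corner+k<n (subst (_≤ n) (+-comm 1 k) (m+n≤o⇒m≤o (suc k) n-large)) ⟩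
        n            ∎
        where open ≤-Reasoning

      α-diagonal-in-T : ∀ {i} → 1 ≤ i → i ≤ k ∸ 1 → T (α i) (r + i + 1) ≡ true
      α-diagonal-in-T {i} 1≤i i≤ with T (α i) (r + i + 1) in notInT
      ... | true  = refl
      ... | false = ⊥-elim (blocking-impossible i 1≤i i≤ _ (witness⇒blocking 1≤i
                      (subst (CrossingWitness (α i)) (+-comm (r + i) 1) (crossingWitness diagonal notInT))))
        where
        diagonal : Diagonal n (α i) (r + i + 1)
        diagonal = InAℕ⇒positive 1≤i (α∈A 1≤i i≤)
                 , +-monoˡ-< 1 (α<r+j 1≤i i≤)
                 , <⇒≤ (r+i+1<n i≤)
                 , λ (_ , r+i+1≡n) → <⇒≢ (r+i+1<n i≤) r+i+1≡n

lemma6p3 : (n k : ℕ) → 2 ≤ k → 2 * k + 2 ≤ n →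
    (T : ℕ → ℕ → Bool) → KTriangulation n k T →
    (r : ℕ) → IsCorner n k T r →
    (a : ℕ → ℤ) → IsASeq n k T r a →
    (i : ℕ) → 1 ≤ i → i ≤ k ∸ 1 →
    InTZ n k T (a i) (r + i + 1) ⊎ TrivialZ n k (a i) (r + i + 1)
lemma6p3 n k 2≤k 2k+2≤n T tri r corner a aseq i 1≤i i≤ =
  in-T-or-trivial ((r + i + 1 ∸ α i ≤? k) ⊎-dec (α i + n ∸ (r + i + 1) ≤? k))
  where
  open Triangulation (≤-trans (s≤s z≤n) 2≤k) T tri
  open Corner corner
  open Sequence 2≤k (subst (_≤ n) (2*k+2≡[1+k]+[1+k] k) 2k+2≤n) aseq

  in-T-or-trivial : Dec (Trivial n k (α i) (r + i + 1)) →
                    InTZ n k T (a i) (r + i + 1) ⊎ TrivialZ n k (a i) (r + i + 1)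
  in-T-or-trivial (no nontrivial) = inj₁ (α i , a≡+α 1≤i i≤ , α-diagonal-in-T 1≤i i≤ , nontrivial)
  in-T-or-trivial (yes trivial)   = inj₂ (subst (λ x → TrivialZ n k x (r + i + 1)) (sym (a≡+α 1≤i i≤))
    (Trivial⇒TrivialZ (≤-trans (<⇒≤ (α<r+j 1≤i i≤)) (m≤m+n (r + i) 1))
                      (≤-trans (<⇒≤ (r+i+1<n i≤)) (m≤n+m n (α i))) trivial))
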